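{- Let $q=p^f$ with $p$ prime. For each $\gamma\in\mathbb{F}_{q^2}^\times$ and $\delta\in\mathbb{F}_{q^2}$ with $\delta^{q+1}=1$, the system of equations \[ a^{p-1}=\gamma^{q+1},\qquad b^p=b\gamma^q\delta,\qquad a+a^q+b^{q+1}=0 \] has at most $p-1$ solutions $(a,b)\in\mathbb{F}_{q^2}\times\mathbb{F}_{q^2}$. -}

module Defs where

open import Level using (_⊔_)
open import Data.Nat using (ℕ; zero; suc)
open import Data.Fin using (Fin)
open import Data.Product using (Σ; ∃; _×_; _,_)
open import Relation.Nullary using (¬_)
open import Relation.Binary using (Decidable)
import Relation.Binary.PropositionalEquality
open import Algebra.Bundles using (CommutativeRing)

record FiniteField (c ℓ : Level.Level) (n : ℕ) : Set (Level.suc (c ⊔ ℓ)) where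
  field
    commRing : CommutativeRing c ℓ
  open CommutativeRing commRing public
  field
    1≉0     : ¬ (1# ≈ 0#)
    inverse : ∀ x → ¬ (x ≈ 0#) → ∃ λ y → x * y ≈ 1#
    _≟_     : Decidable _≈_
    enum    : Fin n → Carrier
    enum-injective  : ∀ i j → enum i ≈ enum j → i Relation.Binary.PropositionalEquality.≡ j
    enum-surjective : ∀ x → ∃ λ i → enum i ≈ x

  infixr 8 _^_
  _^_ : Carrier → ℕ → Carrier
  x ^ zero  = 1#
  x ^ suc k = x * (x ^ k)

module _ {c ℓ n} (F : FiniteField c ℓ n) where
  open FiniteField F
  open import Data.Nat using (_∸_) renaming (_+_ to _+ℕ_)

  IsSolution : (p q : ℕ) (γ δ : Carrier) → Carrier × Carrier → Set ℓ
  IsSolution p q γ δ (a , b) =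
      (a ^ (p ∸ 1) ≈ γ ^ (q +ℕ 1))
    × (b ^ p ≈ b * (γ ^ q) * δ)
    × (a + a ^ q + b ^ (q +ℕ 1) ≈ 0#)

  _≈₂_ : Carrier × Carrier → Carrier × Carrier → Set ℓ
  (a , b) ≈₂ (a′ , b′) = (a ≈ a′) × (b ≈ b′)

-- Write q = p^f and m = p - 1, and Tr a = a + a^q.  If (a, b) and (a′, b′) are solutions,
-- then ζ = a′/a is an m-th root of unity, so ζ^q = ζ because q ≡ 1 (mod m), and hence
-- Tr a′ = ζ Tr a.  The third equation reads Tr a = -b^(q+1), so either every solution has
-- b = 0 or none has.  In the first case the solutions are determined by a, a root of
-- x^m = γ^(q+1); in the second b^m = γ^q δ, and equal b forces Tr a′ = Tr a ≠ 0, so ζ = 1 and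
-- the solutions are determined by b.  Either way a polynomial of degree m has at most m
-- roots.

module Submission where

open import Defs
open import Level using (Level)
import Data.Nat as ℕ
open import Data.Nat.Properties using (m+1+n≢0)
open import Data.Nat.Primality using (Prime)
open import Data.Product using (∃; _×_; _,_; proj₁; proj₂)
open import Data.Sum using (_⊎_; inj₁; inj₂)
open import Data.Empty using (⊥-elim)
open import Data.List using (List; []; _∷_; length; replicate)
open import Data.List.Properties using (length-map; length-replicate)
open import Data.List.Relation.Unary.All as All using (All; []; _∷_)
import Data.List.Relation.Unary.All.Properties as All
open import Data.List.Relation.Unary.AllPairs using (AllPairs; []; _∷_)
import Data.List.Relation.Unary.AllPairs.Properties as AllPairs
open import Relation.Nullary using (¬_; yes; no)
open import Relation.Binary.PropositionalEquality as ≡ using (_≡_)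
import Algebra.Properties.CommutativeSemiring.Exp as ExpProperties
import Algebra.Properties.Ring as RingProperties
import Algebra.Solver.Ring.NaturalCoefficients.Default as NaturalCoefficients
import Relation.Binary.Reasoning.Setoid as SetoidReasoning

module _ {a p r s} {A : Set a} {P : A → Set p} {R : A → A → Set r} {S : A → A → Set s} where

  allPairs-map-within : (∀ {x y} → P x → P y → R x y → S x y) →
                        ∀ {xs} → All P xs → AllPairs R xs → AllPairs S xs
  allPairs-map-within f [] [] = []
  allPairs-map-within f (px ∷ pxs) (rx ∷ rxs) =
    All.zipWith (λ (py , rxy) → f px py rxy) (pxs , rx) ∷ allPairs-map-within f pxs rxs

module FieldProperties {c ℓ n} (F : FiniteField c ℓ n) where
  open FiniteField F
  open SetoidReasoning setoid
  private module Exp = ExpProperties commutativeSemiring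

  ^≡^ : ∀ x k → x ^ k ≡ x Exp.^ k
  ^≡^ x ℕ.zero    = ≡.refl
  ^≡^ x (ℕ.suc k) = ≡.cong (x *_) (^≡^ x k)

  ^-congˡ : ∀ k {x y} → x ≈ y → x ^ k ≈ y ^ k
  ^-congˡ k {x} {y} rewrite ^≡^ x k | ^≡^ y k = Exp.^-congˡ k

  ^-distrib-* : ∀ x y k → (x * y) ^ k ≈ x ^ k * y ^ k
  ^-distrib-* x y k rewrite ^≡^ (x * y) k | ^≡^ x k | ^≡^ y k = Exp.^-distrib-* x y k

  ^-assocʳ : ∀ x j k → (x ^ j) ^ k ≈ x ^ (j ℕ.* k)
  ^-assocʳ x j k rewrite ^≡^ (x ^ j) k | ^≡^ x j | ^≡^ x (j ℕ.* k) = Exp.^-assocʳ x j k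

  ^-fixed-^ : ∀ {x} k f → x ^ k ≈ x → x ^ (k ℕ.^ f) ≈ x
  ^-fixed-^ {x} k ℕ.zero    _     = *-identityʳ x
  ^-fixed-^ {x} k (ℕ.suc f) xᵏ≈x = begin
    x ^ (k ℕ.* k ℕ.^ f)  ≈⟨ ^-assocʳ x k (k ℕ.^ f) ⟨
    (x ^ k) ^ (k ℕ.^ f)  ≈⟨ ^-congˡ (k ℕ.^ f) xᵏ≈x ⟩
    x ^ (k ℕ.^ f)        ≈⟨ ^-fixed-^ k f xᵏ≈x ⟩
    x                    ∎

  root-of-unity-fixed : ∀ {ζ} m f → ζ ^ m ≈ 1# → ζ ^ (ℕ.suc m ℕ.^ f) ≈ ζ
  root-of-unity-fixed {ζ} m f ζᵐ≈1 =
    ^-fixed-^ (ℕ.suc m) f (trans (*-congˡ ζᵐ≈1) (*-identityʳ ζ))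

  *-cancelˡ : ∀ {x y z} → ¬ x ≈ 0# → x * y ≈ x * z → y ≈ z
  *-cancelˡ {x} {y} {z} x≉0 xy≈xz = begin
    y              ≈⟨ *-identityˡ y ⟨
    1# * y         ≈⟨ *-congʳ x⁻¹x≈1 ⟨
    (x⁻¹ * x) * y  ≈⟨ *-assoc x⁻¹ x y ⟩
    x⁻¹ * (x * y)  ≈⟨ *-congˡ xy≈xz ⟩
    x⁻¹ * (x * z)  ≈⟨ *-assoc x⁻¹ x z ⟨
    (x⁻¹ * x) * z  ≈⟨ *-congʳ x⁻¹x≈1 ⟩
    1# * z         ≈⟨ *-identityˡ z ⟩
    z              ∎
    where
    x⁻¹ = proj₁ (inverse x x≉0)
    x⁻¹x≈1 = trans (*-comm x⁻¹ x) (proj₂ (inverse x x≉0))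

  no-zero-divisors : ∀ {x y} → ¬ x ≈ 0# → x * y ≈ 0# → y ≈ 0#
  no-zero-divisors {x} x≉0 xy≈0 = *-cancelˡ x≉0 (trans xy≈0 (sym (zeroʳ x)))

  ^-≉0 : ∀ {x} k → ¬ x ≈ 0# → ¬ x ^ k ≈ 0#
  ^-≉0 ℕ.zero    x≉0 = 1≉0
  ^-≉0 (ℕ.suc k) x≉0 xxᵏ≈0 = ^-≉0 k x≉0 (no-zero-divisors x≉0 xxᵏ≈0)

  ^≈0⇒≈0 : ∀ {x} k → x ^ k ≈ 0# → x ≈ 0#
  ^≈0⇒≈0 {x} k xᵏ≈0 with x ≟ 0#
  ... | yes x≈0 = x≈0
  ... | no  x≉0 = ⊥-elim (^-≉0 k x≉0 xᵏ≈0)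

  ≈0⇒^≈0 : ∀ {x} k .{{_ : ℕ.NonZero k}} → x ≈ 0# → x ^ k ≈ 0#
  ≈0⇒^≈0 (ℕ.suc k) x≈0 = trans (*-congʳ x≈0) (zeroˡ _)

  ratio-of-equal-powers : ∀ {x y} k → ¬ x ≈ 0# → y ^ k ≈ x ^ k →
                          ∃ λ ζ → ζ ^ k ≈ 1# × y ≈ ζ * x
  ratio-of-equal-powers {x} {y} k x≉0 yᵏ≈xᵏ = ζ , ζᵏ≈1 , sym ζx≈y
    where
    x⁻¹ = proj₁ (inverse x x≉0)
    ζ = y * x⁻¹
    ζx≈y : ζ * x ≈ y
    ζx≈y = begin
      y * x⁻¹ * x    ≈⟨ *-assoc y x⁻¹ x ⟩
      y * (x⁻¹ * x)  ≈⟨ *-congˡ (trans (*-comm x⁻¹ x) (proj₂ (inverse x x≉0))) ⟩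
      y * 1#         ≈⟨ *-identityʳ y ⟩
      y              ∎
    ζᵏ≈1 : ζ ^ k ≈ 1#
    ζᵏ≈1 = *-cancelˡ (^-≉0 k x≉0) (begin
      x ^ k * ζ ^ k  ≈⟨ *-comm (x ^ k) (ζ ^ k) ⟩
      ζ ^ k * x ^ k  ≈⟨ ^-distrib-* ζ x k ⟨
      (ζ * x) ^ k    ≈⟨ ^-congˡ k ζx≈y ⟩
      y ^ k          ≈⟨ yᵏ≈xᵏ ⟩
      x ^ k          ≈⟨ *-identityʳ (x ^ k) ⟨
      x ^ k * 1#     ∎)

module MonicPolynomial {c ℓ n} (F : FiniteField c ℓ n) where
  open FiniteField F
  open FieldProperties F
  open SetoidReasoning setoid
  open RingProperties ring using (x∙y⁻¹≈ε⇒x≈y)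
  open NaturalCoefficients commutativeSemiring using (solve; _:=_; _:+_; _:*_)

  -- coefficients from the constant term up, the leading coefficient 1 left implicit
  monic : List Carrier → Carrier → Carrier
  monic []       x = 1#
  monic (c ∷ cs) x = c + x * monic cs x

  deflate : Carrier → List Carrier → List Carrier
  deflate r []       = []
  deflate r (c ∷ cs) = monic (c ∷ cs) r ∷ deflate r cs

  length-deflate : ∀ r cs → length (deflate r cs) ≡ length cs
  length-deflate r []       = ≡.refl
  length-deflate r (c ∷ cs) = ≡.cong ℕ.suc (length-deflate r cs)

  x≈r+[x-r] : ∀ x r → x ≈ r + (x - r)
  x≈r+[x-r] x r = begin
    x              ≈⟨ +-identityʳ x ⟨
    x + 0#         ≈⟨ +-congˡ (-‿inverseˡ r) ⟨
    x + (- r + r)  ≈⟨ +-assoc x (- r) r ⟨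
    (x - r) + r    ≈⟨ +-comm (x - r) r ⟩
    r + (x - r)    ∎

  -- with x - r abbreviated to d, the identity becomes a semiring identity
  monic-factor : ∀ {x r d} c cs → x ≈ r + d →
                 monic (c ∷ cs) x ≈ monic (c ∷ cs) r + d * monic (deflate r cs) x
  monic-factor {x} {r} {d} c [] x≈r+d = begin
    c + x * 1#               ≈⟨ +-congˡ (*-congʳ x≈r+d) ⟩
    c + (r + d) * 1#         ≈⟨ solve 4 (λ c r d one → c :+ (r :+ d) :* one :=
                                  (c :+ r :* one) :+ d :* one) refl c r d 1# ⟩
    (c + r * 1#) + d * 1#    ∎
  monic-factor {x} {r} {d} c (b ∷ bs) x≈r+d = begin
    c + x * monic (b ∷ bs) x           ≈⟨ +-congˡ (*-cong x≈r+d (monic-factor b bs x≈r+d)) ⟩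
    c + (r + d) * (v + d * q)          ≈⟨ solve 5 (λ c r d v q →
                                            c :+ (r :+ d) :* (v :+ d :* q) :=
                                            (c :+ r :* v) :+ d :* (v :+ (r :+ d) :* q)) refl c r d v q ⟩
    (c + r * v) + d * (v + (r + d) * q) ≈⟨ +-congˡ (*-congˡ (+-congˡ (*-congʳ x≈r+d))) ⟨
    (c + r * v) + d * (v + x * q)      ∎
    where
    v = monic (b ∷ bs) r
    q = monic (deflate r bs) x

  monic-roots-bound : ∀ cs {rs} → AllPairs (λ x y → ¬ x ≈ y) rs →
                      All (λ r → monic cs r ≈ 0#) rs → length rs ℕ.≤ length cs
  monic-roots-bound cs       []             []              = ℕ.z≤n
  monic-roots-bound []       (_ ∷ _)        (1≈0 ∷ _)       = ⊥-elim (1≉0 1≈0)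
  monic-roots-bound (c ∷ cs) {r ∷ rs} (r≉rs ∷ distinct) (r-root ∷ roots) =
    ℕ.s≤s (≡.subst (length rs ℕ.≤_) (length-deflate r cs)
      (monic-roots-bound (deflate r cs) distinct (All.zipWith deflated-root (r≉rs , roots))))
    where
    deflated-root : ∀ {x} → ¬ r ≈ x × monic (c ∷ cs) x ≈ 0# → monic (deflate r cs) x ≈ 0#
    deflated-root {x} (r≉x , x-root) = no-zero-divisors x-r≉0 (begin
      (x - r) * q                   ≈⟨ +-identityˡ _ ⟨
      0# + (x - r) * q              ≈⟨ +-congʳ r-root ⟨
      monic (c ∷ cs) r + (x - r) * q ≈⟨ monic-factor c cs (x≈r+[x-r] x r) ⟨
      monic (c ∷ cs) x              ≈⟨ x-root ⟩
      0#                            ∎)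
      where
      q = monic (deflate r cs) x
      x-r≉0 : ¬ x - r ≈ 0#
      x-r≉0 x-r≈0 = r≉x (sym (x∙y⁻¹≈ε⇒x≈y x r x-r≈0))

  monic-replicate-0 : ∀ k x → monic (replicate k 0#) x ≈ x ^ k
  monic-replicate-0 ℕ.zero    x = refl
  monic-replicate-0 (ℕ.suc k) x = trans (+-identityˡ _) (*-congˡ (monic-replicate-0 k x))

  ^-roots-bound : ∀ k .{{_ : ℕ.NonZero k}} a {xs} → AllPairs (λ x y → ¬ x ≈ y) xs →
                  All (λ x → x ^ k ≈ a) xs → length xs ℕ.≤ k
  ^-roots-bound (ℕ.suc k) a {xs} distinct roots =
    ≡.subst (λ d → length xs ℕ.≤ ℕ.suc d) (length-replicate k)
      (monic-roots-bound (- a ∷ replicate k 0#) distinct (All.map root roots))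
    where
    root : ∀ {x} → x ^ ℕ.suc k ≈ a → monic (- a ∷ replicate k 0#) x ≈ 0#
    root {x} xᵏ≈a = trans (+-congˡ (trans (*-congˡ (monic-replicate-0 k x)) xᵏ≈a)) (-‿inverseˡ a)

module Solutions {c ℓ n} (F : FiniteField c ℓ n) (m f : ℕ.ℕ) .{{_ : ℕ.NonZero m}}
                 (γ δ : FiniteField.Carrier F) (γ≉0 : ¬ FiniteField._≈_ F γ (FiniteField.0# F)) where
  open FiniteField F
  open FieldProperties F
  open MonicPolynomial F using (^-roots-bound)
  open SetoidReasoning setoid
  open RingProperties ring using (-0#≈0#; +-inverseˡ-unique; +-inverseʳ-unique)

  p q : ℕ.ℕ
  p = ℕ.suc m
  q = p ℕ.^ f

  Solution : Carrier × Carrier → Set ℓ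
  Solution = IsSolution F p q γ δ

  Distinct : Carrier × Carrier → Carrier × Carrier → Set ℓ
  Distinct s t = ¬ _≈₂_ F s t

  trace norm : Carrier → Carrier
  trace a = a + a ^ q
  norm  b = b ^ (q ℕ.+ 1)

  trace-scale : ∀ {ζ} a → ζ ^ q ≈ ζ → trace (ζ * a) ≈ ζ * trace a
  trace-scale {ζ} a ζ^q≈ζ = begin
    ζ * a + (ζ * a) ^ q      ≈⟨ +-congˡ (^-distrib-* ζ a q) ⟩
    ζ * a + ζ ^ q * a ^ q    ≈⟨ +-congˡ (*-congʳ ζ^q≈ζ) ⟩
    ζ * a + ζ * a ^ q        ≈⟨ distribˡ ζ a (a ^ q) ⟨
    ζ * (a + a ^ q)          ∎

  solution-a≉0 : ∀ {a b} → Solution (a , b) → ¬ a ≈ 0#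
  solution-a≉0 (aᵐ≈γ^[q+1] , _) a≈0 =
    ^-≉0 (q ℕ.+ 1) γ≉0 (trans (sym aᵐ≈γ^[q+1]) (≈0⇒^≈0 m a≈0))

  solutions-ratio : ∀ {a b a′ b′} → Solution (a , b) → Solution (a′ , b′) →
                    ∃ λ ζ → a′ ≈ ζ * a × trace a′ ≈ ζ * trace a
  solutions-ratio {a} {b} {a′} s s′
    with ζ , ζᵐ≈1 , a′≈ζa ← ratio-of-equal-powers m (solution-a≉0 s) (trans (proj₁ s′) (sym (proj₁ s)))
    = ζ , a′≈ζa , trans (+-cong a′≈ζa (^-congˡ q a′≈ζa)) (trace-scale a (root-of-unity-fixed m f ζᵐ≈1))

  trace≈-norm : ∀ {a b} → Solution (a , b) → trace a ≈ - norm b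
  trace≈-norm {a} {b} s = +-inverseˡ-unique (trace a) (norm b) (proj₂ (proj₂ s))

  b≈0⇒trace≈0 : ∀ {a b} → Solution (a , b) → b ≈ 0# → trace a ≈ 0#
  b≈0⇒trace≈0 s b≈0 = trans (trace≈-norm s)
    (trans (-‿cong (≈0⇒^≈0 (q ℕ.+ 1) {{ℕ.≢-nonZero (m+1+n≢0 q)}} b≈0)) -0#≈0#)

  trace≈0⇒b≈0 : ∀ {a b} → Solution (a , b) → trace a ≈ 0# → b ≈ 0#
  trace≈0⇒b≈0 {a} {b} s trace≈0 = ^≈0⇒≈0 (q ℕ.+ 1) (begin
    norm b        ≈⟨ +-inverseʳ-unique (trace a) (norm b) (proj₂ (proj₂ s)) ⟩
    - trace a     ≈⟨ -‿cong trace≈0 ⟩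
    - 0#          ≈⟨ -0#≈0# ⟩
    0#            ∎)

  b≈0-transfer : ∀ {a b a′ b′} → Solution (a , b) → Solution (a′ , b′) → b ≈ 0# → b′ ≈ 0#
  b≈0-transfer {a} {b} {a′} s s′ b≈0 with ζ , _ , trace-a′≈ζtrace-a ← solutions-ratio s s′ =
    trace≈0⇒b≈0 s′ (begin
      trace a′      ≈⟨ trace-a′≈ζtrace-a ⟩
      ζ * trace a   ≈⟨ *-congˡ (b≈0⇒trace≈0 s b≈0) ⟩
      ζ * 0#        ≈⟨ zeroʳ ζ ⟩
      0#            ∎)

  b-dichotomy : ∀ {sols} → All Solution sols →
                All (λ s → proj₂ s ≈ 0#) sols ⊎ All (λ s → ¬ proj₂ s ≈ 0#) sols
  b-dichotomy [] = inj₁ []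
  b-dichotomy {(a , b) ∷ _} all@(s ∷ _) with b ≟ 0#
  ... | yes b≈0 = inj₁ (All.map (λ s′ → b≈0-transfer s s′ b≈0) all)
  ... | no  b≉0 = inj₂ (All.map (λ s′ b′≈0 → b≉0 (b≈0-transfer s′ s b′≈0)) all)

  length≤-by-roots : (g : Carrier × Carrier → Carrier) (x : Carrier) {P : Carrier × Carrier → Set ℓ} →
                     (∀ {s} → P s → g s ^ m ≈ x) →
                     (∀ {s t} → P s → P t → Distinct s t → ¬ g s ≈ g t) →
                     ∀ {sols} → All P sols → AllPairs Distinct sols → length sols ℕ.≤ m
  length≤-by-roots g x root injective {sols} Ps distinct =
    ≡.subst (ℕ._≤ m) (length-map g sols)
      (^-roots-bound m x (AllPairs.map⁺ (allPairs-map-within injective Ps distinct))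
                         (All.map⁺ (All.map root Ps)))

  b≉0⇒b^m≈γ^qδ : ∀ {a b} → Solution (a , b) → ¬ b ≈ 0# → b ^ m ≈ γ ^ q * δ
  b≉0⇒b^m≈γ^qδ {b = b} (_ , bᵖ≈bγ^qδ , _) b≉0 =
    *-cancelˡ b≉0 (trans bᵖ≈bγ^qδ (*-assoc b (γ ^ q) δ))

  b≈b′⇒a≈a′ : ∀ {a b a′ b′} → Solution (a , b) → Solution (a′ , b′) → ¬ b ≈ 0# → b ≈ b′ → a ≈ a′
  b≈b′⇒a≈a′ {a} {b} {a′} {b′} s s′ b≉0 b≈b′
    with ζ , a′≈ζa , trace-a′≈ζtrace-a ← solutions-ratio s s′ = begin
      a        ≈⟨ *-identityˡ a ⟨
      1# * a   ≈⟨ *-congʳ ζ≈1 ⟨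
      ζ * a    ≈⟨ a′≈ζa ⟨
      a′       ∎
    where
    trace≉0 : ¬ trace a ≈ 0#
    trace≉0 trace≈0 = b≉0 (trace≈0⇒b≈0 s trace≈0)
    ζ≈1 : ζ ≈ 1#
    ζ≈1 = *-cancelˡ trace≉0 (begin
      trace a * ζ    ≈⟨ *-comm (trace a) ζ ⟩
      ζ * trace a    ≈⟨ trace-a′≈ζtrace-a ⟨
      trace a′       ≈⟨ trace≈-norm s′ ⟩
      - norm b′      ≈⟨ -‿cong (^-congˡ (q ℕ.+ 1) b≈b′) ⟨
      - norm b       ≈⟨ trace≈-norm s ⟨
      trace a        ≈⟨ *-identityʳ (trace a) ⟨
      trace a * 1#   ∎)

  solutions-bound : ∀ {sols} → AllPairs Distinct sols → All Solution sols → length sols ℕ.≤ m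
  solutions-bound distinct sols with b-dichotomy sols
  ... | inj₁ b≈0s = length≤-by-roots proj₁ (γ ^ (q ℕ.+ 1)) (λ (_ , s) → proj₁ s) a-injective
                      (All.zip (b≈0s , sols)) distinct
    where
    a-injective : ∀ {s t} → proj₂ s ≈ 0# × Solution s → proj₂ t ≈ 0# × Solution t →
                  Distinct s t → ¬ proj₁ s ≈ proj₁ t
    a-injective (b≈0 , _) (b′≈0 , _) s≉t a≈a′ = s≉t (a≈a′ , trans b≈0 (sym b′≈0))
  ... | inj₂ b≉0s = length≤-by-roots proj₂ (γ ^ q * δ) (λ (b≉0 , s) → b≉0⇒b^m≈γ^qδ s b≉0)
                      b-injective (All.zip (b≉0s , sols)) distinct
    where
    b-injective : ∀ {s t} → ¬ proj₂ s ≈ 0# × Solution s → ¬ proj₂ t ≈ 0# × Solution t →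
                  Distinct s t → ¬ proj₂ s ≈ proj₂ t
    b-injective (b≉0 , s) (_ , s′) s≉t b≈b′ = s≉t (b≈b′⇒a≈a′ s s′ b≉0 b≈b′ , b≈b′)

open import Data.Nat using (ℕ; _^_; _+_; _∸_; _≤_)

lemma2p1 : ∀ {c ℓ : Level} (p f : ℕ) → Prime p →
           (F : FiniteField c ℓ ((p ^ f) ^ 2)) →
           (γ δ : FiniteField.Carrier F) → ¬ (FiniteField._≈_ F γ (FiniteField.0# F)) →
           FiniteField._≈_ F (FiniteField._^_ F δ (p ^ f + 1)) (FiniteField.1# F) →
           (sols : List (FiniteField.Carrier F × FiniteField.Carrier F)) →
           AllPairs (λ s t → ¬ (_≈₂_ F s t)) sols →
           All (IsSolution F p (p ^ f) γ δ) sols →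
           length sols ≤ p ∸ 1
lemma2p1 (ℕ.suc (ℕ.suc m)) f _ F γ δ γ≉0 _ _ = Solutions.solutions-bound F (ℕ.suc m) f γ δ γ≉0
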